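{- Let $k\ge 1$. An order ideal $I$ of $P_{2k+1,2k+3}$ contains no two consecutive integers if and only if the order ideal $I'=\psi(I)$ of $P'_{2k+1,2k+3}$ does not contain both $l_{x_0}$ and $r_{x_0}$ for any $1\le x_0\le k$, and does not contain both $r_{x_1}$ and $l_{x_1+1}$ for any $1\le x_1<k$.
   Context: $\mathbb{N}$ denotes the non-negative integers. For coprime positive integers $s,t$, let $F_{s,t}=st-s-t$ and $P_{s,t}=\mathbb{N}\setminus\{as+bt: a,b\in\mathbb{N}\}$, partially ordered as the reflexive-transitive closure of: $x$ covers $y$ iff $x-y\in\{s,t\}$. Every $x\in P_{s,t}$ is uniquely $x=F_{s,t}-as-bt$ with $a,b\in\mathbb{N}$. Let $P'_{s,t}=\{(a,b)\in\mathbb{N}^2\mid as+bt\le F_{s,t}\}$ with order $(a_1,b_1)\le(a_0,b_0)$ iff $a_0\le a_1$ and $b_0\le b_1$; the map $\psi(F_{s,t}-as-bt)=(a,b)$ is a poset isomorphism $P_{s,t}\to P'_{s,t}$. An order ideal is a subset $I$ with $y\in I$, $x\le y\Rightarrow x\in I$. For $1\le i\le k$, $l_i=(k+i,k-i)$ and $r_i=(i-1,2k-i)$. -}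

module Defs where

open import Data.Nat using (ℕ; zero; suc; _+_; _*_; _∸_; _≤_)
open import Data.Product using (Σ; ∃; _×_; _,_)
open import Data.Sum using (_⊎_)
open import Relation.Nullary using (¬_)
open import Relation.Binary.PropositionalEquality using (_≡_)
open import Relation.Binary.Construct.Closure.ReflexiveTransitive using (Star)

F : ℕ → ℕ → ℕ
F s t = s * t ∸ s ∸ t

Representable : ℕ → ℕ → ℕ → Set
Representable s t n = Σ ℕ λ a → Σ ℕ λ b → a * s + b * t ≡ n

InP : ℕ → ℕ → ℕ → Set
InP s t n = ¬ Representable s t n

Covers : ℕ → ℕ → ℕ → ℕ → Set
Covers s t x y = InP s t x × InP s t y × (x ≡ y + s ⊎ x ≡ y + t)

_≤[_,_]_ : ℕ → ℕ → ℕ → ℕ → Set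
y ≤[ s , t ] x = Star (Covers s t) x y

OrderIdeal : ℕ → ℕ → (ℕ → Set) → Set
OrderIdeal s t I =
  (∀ x → I x → InP s t x) ×
  (∀ x y → I y → x ≤[ s , t ] y → I x)

NoConsecutive : (ℕ → Set) → Set
NoConsecutive I = ∀ n → ¬ (I n × I (suc n))

ψImage : ℕ → ℕ → (ℕ → Set) → ℕ × ℕ → Set
ψImage s t I (a , b) = Σ ℕ λ x → I x × x + (a * s + b * t) ≡ F s t

-- l_i = (k+i, k-i),  r_i = (i-1, 2k-i)   (used for 1 ≤ i ≤ k)
l : ℕ → ℕ → ℕ × ℕ
l k i = (k + i , k ∸ i)

r : ℕ → ℕ → ℕ × ℕ
r k i = (i ∸ 1 , 2 * k ∸ i)

-- ψ sends l_i to 2i − 1 and r_i to 2i, so the forbidden pairs of the statement are exactly the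
-- pairs of consecutive integers in [1, 2k].  Any consecutive pair n, n + 1 in I reduces to such a
-- pair: write n = e·s + m with m < s = 2k + 1.  Since multiples of s are not gaps, m ≠ 0 and
-- m + 1 ≠ s, and subtracting s repeatedly walks down the covering relation, so m and m + 1 lie in I.
module Submission where

open import Defs
open import Data.Nat using (ℕ; zero; suc; pred; _+_; _*_; _∸_; _≤_; _<_; NonZero; >-nonZero; z≤n; s≤s)
open import Data.Nat.Properties
open import Data.Nat.DivMod using (_%_; _/_; m≡m%n+[m/n]*n; m%n<n)
open import Data.Nat.Tactic.RingSolver using (solve-∀)
open import Data.Product using (_×_; ∃-syntax; _,_)
open import Data.Sum using (_⊎_; inj₁; inj₂)
open import Function.Bundles using (_⇔_; mk⇔; Equivalence)
open import Relation.Nullary using (¬_)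
open import Relation.Binary.PropositionalEquality
open import Relation.Binary.Construct.Closure.ReflexiveTransitive using (ε; _◅_)

module _ {s t : ℕ} where

  Representable-s+ : ∀ {n} → Representable s t n → Representable s t (s + n)
  Representable-s+ (a , b , eq) = suc a , b , trans (+-assoc s (a * s) (b * t)) (cong (s +_) eq)

  InP-s+⇒InP : ∀ {n} → InP s t (s + n) → InP s t n
  InP-s+⇒InP s+n∈P rep = s+n∈P (Representable-s+ rep)

  multiple-∉P : ∀ e → ¬ InP s t (e * s)
  multiple-∉P e e*s∈P = e*s∈P (e , 0 , +-identityʳ (e * s))

  ≤-+multiple : ∀ e {m} → InP s t (e * s + m) → m ≤[ s , t ] (e * s + m)
  ≤-+multiple zero    _     = ε
  ≤-+multiple (suc e) {m} x∈P = (x∈P , y∈P , inj₁ x≡y+s) ◅ ≤-+multiple e y∈P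
    where
    x≡y+s : s + e * s + m ≡ e * s + m + s
    x≡y+s = trans (+-assoc s (e * s) m) (+-comm s (e * s + m))
    y∈P : InP s t (e * s + m)
    y∈P = InP-s+⇒InP (subst (InP s t) (+-assoc s (e * s) m) x∈P)

  OrderIdeal-∸multiple : ∀ {I} → OrderIdeal s t I → ∀ e {m} → I (e * s + m) → I m
  OrderIdeal-∸multiple (I⊆P , down) e x∈I = down _ _ x∈I (≤-+multiple e (I⊆P _ x∈I))

NoConsecutiveBelow : ℕ → (ℕ → Set) → Set
NoConsecutiveBelow s I = ∀ m → 1 ≤ m → suc m < s → ¬ (I m × I (suc m))

NoConsecutiveBelow⇒NoConsecutive : ∀ {s t I} .{{_ : NonZero s}} → OrderIdeal s t I →
                                   NoConsecutiveBelow s I → NoConsecutive I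
NoConsecutiveBelow⇒NoConsecutive {s} {t} {I} ideal@(I⊆P , _) below n (n∈I , n+1∈I) =
  below m 1≤m m+1<s (OrderIdeal-∸multiple ideal e (subst I n≡ n∈I) ,
                     OrderIdeal-∸multiple ideal e (subst I n+1≡ n+1∈I))
  where
  m = n % s
  e = n / s
  n≡ : n ≡ e * s + m
  n≡ = trans (m≡m%n+[m/n]*n n s) (+-comm m (e * s))
  n+1≡ : suc n ≡ e * s + suc m
  n+1≡ = trans (cong suc n≡) (sym (+-suc (e * s) m))
  1≤m : 1 ≤ m
  1≤m = n≢0⇒n>0 λ m≡0 → multiple-∉P e
    (subst (InP s t) (trans n≡ (trans (cong (e * s +_) m≡0) (+-identityʳ (e * s)))) (I⊆P n n∈I))
  m+1<s : suc m < s
  m+1<s = ≤∧≢⇒< (m%n<n n s) λ m+1≡s → multiple-∉P (suc e)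
    (subst (InP s t) (trans n+1≡ (trans (cong (e * s +_) m+1≡s) (+-comm (e * s) s))) (I⊆P (suc n) n+1∈I))

F-from-product : ∀ {s t n} → s * t ≡ n + t + s → F s t ≡ n
F-from-product {s} {t} {n} st≡ = begin
  s * t ∸ s ∸ t      ≡⟨ cong (λ z → z ∸ s ∸ t) st≡ ⟩
  n + t + s ∸ s ∸ t  ≡⟨ cong (_∸ t) (m+n∸n≡m (n + t) s) ⟩
  n + t ∸ t          ≡⟨ m+n∸n≡m n t ⟩
  n                  ∎
  where open ≡-Reasoning

ψImage⇔ : ∀ {I x} s t a b → x + (a * s + b * t) ≡ F s t → ψImage s t I (a , b) ⇔ I x
ψImage⇔ {I} {x} s t a b x+≡F = mk⇔
  (λ (y , y∈I , y+≡F) → subst I (+-cancelʳ-≡ (a * s + b * t) y x (trans y+≡F (sym x+≡F))) y∈I)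
  (λ x∈I → x , x∈I , x+≡F)

-- Here i = suc p and k = i + q; the leading p + suc (p + 0) is pred (2 * i), spelled out for the solver.
l-identity : ∀ p q → let k = suc p + q in
  (2 * k + 1) * (2 * k + 3) ≡ p + suc (p + 0) + ((k + suc p) * (2 * k + 1) + q * (2 * k + 3)) + (2 * k + 3) + (2 * k + 1)
l-identity = solve-∀

r-identity : ∀ p q → let k = suc p + q in
  (2 * k + 1) * (2 * k + 3) ≡ 2 * suc p + (p * (2 * k + 1) + (suc p + 2 * q) * (2 * k + 3)) + (2 * k + 3) + (2 * k + 1)
r-identity = solve-∀

2k∸i≡i+2q : ∀ p q → 2 * (suc p + q) ∸ suc p ≡ suc p + 2 * q
2k∸i≡i+2q p q = begin
  2 * (suc p + q) ∸ suc p            ≡⟨ cong (_∸ suc p) (double p q) ⟩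
  suc p + (suc p + 2 * q) ∸ suc p    ≡⟨ m+n∸m≡n (suc p) (suc p + 2 * q) ⟩
  suc p + 2 * q                      ∎
  where
  open ≡-Reasoning
  double : ∀ p q → 2 * (suc p + q) ≡ suc p + (suc p + 2 * q)
  double = solve-∀

l-position : ∀ p q → let k = suc p + q in
             pred (2 * suc p) + ((k + suc p) * (2 * k + 1) + (k ∸ suc p) * (2 * k + 3)) ≡ F (2 * k + 1) (2 * k + 3)
l-position p q = trans (cong (λ b → pred (2 * suc p) + ((k + suc p) * (2 * k + 1) + b * (2 * k + 3)))
                             (m+n∸m≡n (suc p) q))
                       (sym (F-from-product (l-identity p q)))
  where k = suc p + q

r-position : ∀ p q → let k = suc p + q in
             2 * suc p + (p * (2 * k + 1) + (2 * k ∸ suc p) * (2 * k + 3)) ≡ F (2 * k + 1) (2 * k + 3)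
r-position p q = trans (cong (λ b → 2 * suc p + (p * (2 * k + 1) + b * (2 * k + 3)))
                             (2k∸i≡i+2q p q))
                       (sym (F-from-product (r-identity p q)))
  where k = suc p + q

ψImageₖ : ℕ → (ℕ → Set) → ℕ × ℕ → Set
ψImageₖ k = ψImage (2 * k + 1) (2 * k + 3)

ψImage-l⇔ : ∀ {k i I} → 1 ≤ i → i ≤ k →
            ψImageₖ k I (l k i) ⇔ I (pred (2 * i))
ψImage-l⇔ {k} {suc p} _ i≤k with m≤n⇒∃[o]m+o≡n i≤k
... | q , refl = ψImage⇔ (2 * k + 1) (2 * k + 3) (k + suc p) (k ∸ suc p) (l-position p q)

ψImage-r⇔ : ∀ {k i I} → 1 ≤ i → i ≤ k →
            ψImageₖ k I (r k i) ⇔ I (2 * i)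
ψImage-r⇔ {k} {suc p} _ i≤k with m≤n⇒∃[o]m+o≡n i≤k
... | q , refl = ψImage⇔ (2 * k + 1) (2 * k + 3) p (2 * k ∸ suc p) (r-position p q)

NoAdjacentLR : ℕ → (ℕ → Set) → Set
NoAdjacentLR k I =
  (∀ x₀ → 1 ≤ x₀ → x₀ ≤ k → ¬ (ψImageₖ k I (l k x₀) × ψImageₖ k I (r k x₀))) ×
  (∀ x₁ → 1 ≤ x₁ → x₁ < k → ¬ (ψImageₖ k I (r k x₁) × ψImageₖ k I (l k (suc x₁))))

pred[2*suc]≡suc[2*] : ∀ i → pred (2 * suc i) ≡ suc (2 * i)
pred[2*suc]≡suc[2*] i = +-suc i (i + 0)

even-or-odd : ∀ m → ∃[ i ] (m ≡ 2 * i ⊎ m ≡ suc (2 * i))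
even-or-odd zero = 0 , inj₁ refl
even-or-odd (suc m) with even-or-odd m
... | i , inj₁ m≡2i   = i , inj₂ (cong suc m≡2i)
... | i , inj₂ m≡2i+1 = suc i , inj₁ (cong suc (trans m≡2i+1 (sym (pred[2*suc]≡suc[2*] i))))

<-+1⇒≤ : ∀ {m n} → m < n + 1 → m ≤ n
<-+1⇒≤ {m} {n} m<n+1 = ≤-pred (subst (m <_) (+-comm n 1) m<n+1)

NoConsecutive⇒NoAdjacentLR : ∀ {k I} → NoConsecutive I → NoAdjacentLR k I
NoConsecutive⇒NoAdjacentLR {k} {I} noConsecutive = lᵢrᵢ , rᵢlᵢ₊₁
  where
  lᵢrᵢ : ∀ i → 1 ≤ i → i ≤ k → ¬ (ψImageₖ k I (l k i) × ψImageₖ k I (r k i))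
  lᵢrᵢ (suc p) 1≤i i≤k (lᵢ∈ , rᵢ∈) =
    noConsecutive (pred (2 * suc p))
      (Equivalence.to (ψImage-l⇔ 1≤i i≤k) lᵢ∈ , Equivalence.to (ψImage-r⇔ 1≤i i≤k) rᵢ∈)
  rᵢlᵢ₊₁ : ∀ i → 1 ≤ i → i < k → ¬ (ψImageₖ k I (r k i) × ψImageₖ k I (l k (suc i)))
  rᵢlᵢ₊₁ i 1≤i i<k (rᵢ∈ , lᵢ₊₁∈) =
    noConsecutive (2 * i)
      (Equivalence.to (ψImage-r⇔ 1≤i (<⇒≤ i<k)) rᵢ∈ ,
       subst I (pred[2*suc]≡suc[2*] i) (Equivalence.to (ψImage-l⇔ (s≤s z≤n) i<k) lᵢ₊₁∈))

NoAdjacentLR⇒NoConsecutiveBelow : ∀ {k I} → NoAdjacentLR k I → NoConsecutiveBelow (2 * k + 1) I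
NoAdjacentLR⇒NoConsecutiveBelow {k} {I} (lᵢrᵢ , rᵢlᵢ₊₁) m 1≤m m+1<s (m∈ , m+1∈) with even-or-odd m
... | zero , inj₁ refl with () ← 1≤m
... | suc j , inj₁ m≡2i =
  rᵢlᵢ₊₁ (suc j) (s≤s z≤n) i<k
    (Equivalence.from (ψImage-r⇔ (s≤s z≤n) (<⇒≤ i<k)) (subst I m≡2i m∈) ,
     Equivalence.from (ψImage-l⇔ (s≤s z≤n) i<k) (subst I m+1≡pred[2i+2] m+1∈))
  where
  m+1≡pred[2i+2] : suc m ≡ pred (2 * suc (suc j))
  m+1≡pred[2i+2] = trans (cong suc m≡2i) (sym (pred[2*suc]≡suc[2*] (suc j)))
  i<k : suc j < k
  i<k = *-cancelˡ-< 2 (suc j) k (subst (_< 2 * k) m≡2i (<-+1⇒≤ m+1<s))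
... | j , inj₂ m≡2j+1 =
  lᵢrᵢ (suc j) (s≤s z≤n) i≤k
    (Equivalence.from (ψImage-l⇔ (s≤s z≤n) i≤k) (subst I m≡pred[2i] m∈) ,
     Equivalence.from (ψImage-r⇔ (s≤s z≤n) i≤k) (subst I (cong suc m≡pred[2i]) m+1∈))
  where
  m≡pred[2i] : m ≡ pred (2 * suc j)
  m≡pred[2i] = trans m≡2j+1 (sym (pred[2*suc]≡suc[2*] j))
  i≤k : suc j ≤ k
  i≤k = *-cancelˡ-≤ 2 (subst (_≤ 2 * k) (cong suc m≡pred[2i]) (<-+1⇒≤ m+1<s))

lemma3p7 : (k : ℕ) → 1 ≤ k → (I : ℕ → Set) →
    OrderIdeal (2 * k + 1) (2 * k + 3) I →
    (NoConsecutive I ⇔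
      ((∀ x₀ → 1 ≤ x₀ → x₀ ≤ k →
          ¬ (ψImage (2 * k + 1) (2 * k + 3) I (l k x₀) × ψImage (2 * k + 1) (2 * k + 3) I (r k x₀)))
       × (∀ x₁ → 1 ≤ x₁ → x₁ < k →
          ¬ (ψImage (2 * k + 1) (2 * k + 3) I (r k x₁) × ψImage (2 * k + 1) (2 * k + 3) I (l k (suc x₁))))))
lemma3p7 k _ I ideal = mk⇔
  NoConsecutive⇒NoAdjacentLR
  (λ noAdjacent → NoConsecutiveBelow⇒NoConsecutive {{s≢0}} ideal (NoAdjacentLR⇒NoConsecutiveBelow noAdjacent))
  where
  s≢0 : NonZero (2 * k + 1)
  s≢0 = >-nonZero (m≤n+m 1 (2 * k))
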